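{- Let $n\ge 2$ and let $\Pi'_n$ be the output of the greedy algorithm described in the context. Then $\Pi'_n$ covers every $n$-permutation, i.e. for every permutation $p$ of $\{1,\dots,n\}$ there is a factor $u$ of $\Pi'_n$ of length $n$ with $\mathrm{red}(u)=p$.
   Context: For a word $w$ of distinct integers, $\mathrm{red}(w)$ denotes the word obtained by replacing the $i$-th smallest entry of $w$ by $i$. A factor of a word is a block of consecutive letters. Extensions: for a word $\pi=\pi_1\cdots\pi_m$ of distinct integers and $1\le i\le m$, the $i$-th extension of $\pi$ is $c_b(\pi_1)\cdots c_b(\pi_m)\,b$, where $b$ is the $i$-th smallest element of $\{\pi_1,\dots,\pi_m\}$ and $c_b(x)=x$ if $x<b$, $c_b(x)=x+1$ if $x\ge b$. The $(m+1)$-st extension of $\pi$ is $\pi b$ with $b=\max_j\pi_j+1$. Greedy algorithm: start with $\Pi'_{n,0}=12\cdots(n-1)$. Given $\Pi'_{n,k}=a_1a_2\cdots a_{k+n-1}$ (a permutation of $\{1,\dots,k+n-1\}$ in which no two factors of length $n$ have the same reduced form), let $i\in\{1,\dots,n\}$ be minimal such that the $i$-th extension of $a_{k+1}\cdots a_{k+n-1}$ has reduced form different from the reduced form of every length-$n$ factor of $\Pi'_{n,k}$, let $b$ be the last element of this extension, and set $\Pi'_{n,k+1}=c_b(a_1)\cdots c_b(a_{k+n-1})\,b$. If no such $i$ exists, the algorithm terminates and outputs $\Pi'_n:=\Pi'_{n,k}$. -}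

module Defs where

open import Data.Nat using (ℕ; zero; suc; _+_; _∸_; _<_; _≤_; _<ᵇ_; _≤ᵇ_; _⊔_)
open import Data.Nat.Properties using (_≟_)
open import Data.Bool using (Bool; true; false; if_then_else_)
open import Data.List using (List; []; _∷_; _++_; map; length; take; drop; upTo; foldr; filter; [_])
import Data.List.Properties as LP
open import Data.List.Membership.DecPropositional (LP.≡-dec _≟_) using (_∈?_)
open import Data.List.Membership.Propositional using (_∈_)
open import Data.List.Relation.Binary.Permutation.Propositional using (_↭_)
open import Data.Maybe using (Maybe; just; nothing)
open import Data.Product using (Σ; ∃; _×_; _,_)
open import Relation.Nullary using (¬_; yes; no)
open import Relation.Binary.PropositionalEquality using (_≡_)

countLess : ℕ → List ℕ → ℕ
countLess x []       = 0
countLess x (y ∷ ys) = if y <ᵇ x then suc (countLess x ys) else countLess x ys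

red : List ℕ → List ℕ
red w = map (λ x → suc (countLess x w)) w

c : ℕ → ℕ → ℕ
c b x = if x <ᵇ b then x else suc x

insert : ℕ → List ℕ → List ℕ
insert x []       = x ∷ []
insert x (y ∷ ys) = if x ≤ᵇ y then x ∷ y ∷ ys else y ∷ insert x ys

sort : List ℕ → List ℕ
sort = foldr insert []

maxL : List ℕ → ℕ
maxL = foldr _⊔_ 0

nth : ℕ → List ℕ → ℕ → ℕ
nth d []       _       = d
nth d (x ∷ xs) zero    = x
nth d (x ∷ xs) (suc i) = nth d xs i

-- the value b used by the i-th extension of π (1 ≤ i ≤ m+1, m = length π):
-- the i-th smallest entry of π for i ≤ m, and max π + 1 for i = m + 1
extB : List ℕ → ℕ → ℕ
extB π i = nth (suc (maxL π)) (sort π ++ [ suc (maxL π) ]) (i ∸ 1)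

-- the i-th extension of π : c_b(π_1) ⋯ c_b(π_m) b
-- (for i = m+1, c_b is the identity on π since b > max π)
extension : List ℕ → ℕ → List ℕ
extension π i = map (c (extB π i)) π ++ [ extB π i ]

windows : ℕ → List ℕ → List (List ℕ)
windows n []       = []
windows n (x ∷ xs) =
  (if n ≤ᵇ length (x ∷ xs) then [ take n (x ∷ xs) ] else []) ++ windows n xs

suffix : ℕ → List ℕ → List ℕ
suffix n w = drop (length w ∸ (n ∸ 1)) w

isNew : ℕ → List ℕ → List ℕ → Bool
isNew n w e with red e ∈? map red (windows n w)
... | yes _ = false
... | no  _ = true

-- search i = j, j+1, …, n (j = n ∸ r) for the minimal admissible extension index
search : ℕ → List ℕ → ℕ → ℕ → Maybe ℕ
search n w i zero    = nothing
search n w i (suc r) =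
  if isNew n w (extension (suffix n w) i) then just i else search n w (suc i) r

-- one step of the greedy algorithm (nothing = the algorithm terminates)
step : ℕ → List ℕ → Maybe (List ℕ)
step n w with search n w 1 n
... | nothing = nothing
... | just i  = let b = extB (suffix n w) i in just (map (c b) w ++ [ b ])

start : ℕ → List ℕ
start n = map suc (upTo (n ∸ 1))

-- Reaches n w : w = Π'_{n,k} for some k
data Reaches (n : ℕ) : List ℕ → Set where
  init : Reaches n (start n)
  next : ∀ {w w′} → Reaches n w → step n w ≡ just w′ → Reaches n w′

IsOutput : ℕ → List ℕ → Set
IsOutput n w = Reaches n w × step n w ≡ nothing

Factor : List ℕ → List ℕ → Set
Factor u w = Σ (List ℕ) λ xs → Σ (List ℕ) λ ys → w ≡ xs ++ u ++ ys

IsPerm : ℕ → List ℕ → Set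
IsPerm n p = p ↭ map suc (upTo n)

Covers : ℕ → List ℕ → Set
Covers n w = ∀ p → IsPerm n p →
  Σ (List ℕ) λ u → Factor u w × length u ≡ n × red u ≡ p

-- Read each reduced factor q = red W of length n = m + 1 as an edge from the pattern
-- red (take m q) to the pattern red (drop 1 q). Consecutive factors overlap in m letters, so
-- the factors of Π′_{n,k} form a walk from 12⋯m to the pattern s of its last m letters, and
-- the greedy algorithm never repeats an edge; as there are finitely many patterns, it halts.
-- Then all n extensions of s are used, so s has out-degree n, while every pattern has
-- in-degree at most n because an edge is determined by its target and its first letter;
-- hence the walk is closed and every pattern has equal in- and out-degree. The greedy rule
-- uses the j-th extension of a pattern only after all smaller ones, so if the n-th extension
-- of u is used then u has out-degree n, hence in-degree n, and every edge into u is used.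
-- The n-th extension of u leads to the pattern of "u without its first letter, followed by
-- a new maximum"; m such steps reach 12⋯m = s, whose n-th extension is used. Going back
-- along this chain, the n-th extension, and hence every extension, of every pattern is used.

module Submission where

open import Defs
open import Data.Bool using (true; false)
open import Data.Nat using (ℕ; zero; suc; _+_; _∸_; _<_; _≤_; _<ᵇ_; _≤ᵇ_; z≤n; s≤s; z<s)
open import Data.Nat.Properties
open import Data.Product using (Σ; _×_; _,_)
import Data.Product as Product
open import Data.Sum using (inj₁; inj₂)
open import Data.Maybe using (just; nothing)
open import Data.List
  using (List; []; _∷_; _++_; [_]; map; length; take; drop; upTo; concatMap; filter; initLast; _∷ʳ′_)
open import Data.List.Properties
  using ( ≡-dec; ∷-injectiveˡ; ∷-injectiveʳ; ∷ʳ-injective; ++-assoc; ++-identityʳ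
        ; map-∘; map-++; map-cong; map-cong-local; map-id-local; map-injective
        ; length-++; length-++-sucʳ; length-map; length-take; length-drop; length-upTo; upTo-∷ʳ
        ; take-all; take-take; take-map; drop-map; take++drop≡id; filter-++; filter-accept; filter-reject )
open import Data.List.Membership.Propositional using (_∈_; _∉_)
open import Data.List.Membership.Propositional.Properties
  using ( ∈-map⁺; ∈-map⁻; ∈-upTo⁺; ∈-upTo⁻; ∈-++⁺ˡ; ∈-++⁺ʳ; ∈-++⁻; ∈-∃++; ∈-concatMap⁺
        ; ∈-filter⁺; ∈-filter⁻ )
open import Data.List.Membership.DecPropositional (≡-dec _≟_) using (_∈?_)
import Data.List.Relation.Unary.Any as Any
open import Data.List.Relation.Unary.Any using (here; there)
open import Data.List.Relation.Unary.All as All using (All; []; _∷_)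
import Data.List.Relation.Unary.All.Properties as All
open import Data.List.Relation.Unary.AllPairs using (AllPairs; []; _∷_)
open import Data.List.Relation.Unary.Unique.Propositional using (Unique)
open import Data.List.Relation.Unary.Unique.Propositional.Properties
  using (Unique[x∷xs]⇒x∉xs; ++⁺; upTo⁺; drop⁺; filter⁺)
open import Data.List.Relation.Binary.Subset.Propositional using (_⊆_)
open import Data.List.Relation.Binary.Subset.Propositional.Properties using (⊆-refl; xs⊆xs++ys; xs⊆ys++xs)
open import Data.List.Relation.Binary.Permutation.Propositional
  using (_↭_; ↭-sym; refl; prep; swap; trans; ↭⇒↭ₛ)
open import Data.List.Relation.Binary.Permutation.Propositional.Properties
  using (∷↭∷ʳ; ∈-resp-↭; All-resp-↭; ↭-length)
open import Relation.Nullary using (¬_; contradiction; yes; no; does)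
open import Relation.Nullary.Reflects using (ofʸ; ofⁿ)
open import Relation.Binary using (tri<; tri≈; tri>; DecidableEquality)
open import Relation.Binary.PropositionalEquality
  using (_≡_; _≢_; refl; sym; cong; cong₂; subst; subst₂; setoid; module ≡-Reasoning)
  renaming (trans to ≡-trans)

open ≡-Reasoning

<ᵇ-true : ∀ {x y} → x < y → (x <ᵇ y) ≡ true
<ᵇ-true {x} {y} x<y with x <ᵇ y | <ᵇ-reflects-< x y
... | true  | _        = refl
... | false | ofⁿ x≮y = contradiction x<y x≮y

<ᵇ-false : ∀ {x y} → y ≤ x → (x <ᵇ y) ≡ false
<ᵇ-false {x} {y} y≤x with x <ᵇ y | <ᵇ-reflects-< x y
... | true  | ofʸ x<y = contradiction x<y (≤⇒≯ y≤x)
... | false | _        = refl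

≤ᵇ-true : ∀ {x y} → x ≤ y → (x ≤ᵇ y) ≡ true
≤ᵇ-true {x} {y} x≤y with x ≤ᵇ y | ≤ᵇ-reflects-≤ x y
... | true  | _        = refl
... | false | ofⁿ x≰y = contradiction x≤y x≰y

≤ᵇ-false : ∀ {x y} → y < x → (x ≤ᵇ y) ≡ false
≤ᵇ-false {x} {y} y<x with x ≤ᵇ y | ≤ᵇ-reflects-≤ x y
... | true  | ofʸ x≤y = contradiction x≤y (<⇒≱ y<x)
... | false | _        = refl

-- Lists with distinct entries

length-snoc : ∀ {A : Set} (w : List A) b → length (w ++ [ b ]) ≡ suc (length w)
length-snoc w b = ≡-trans (length-++ w) (+-comm _ 1)

take-++ˡ : ∀ {A : Set} {m} (xs ys : List A) → m ≤ length xs → take m (xs ++ ys) ≡ take m xs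
take-++ˡ {m = zero}  xs       ys _         = refl
take-++ˡ {m = suc m} (x ∷ xs) ys (s≤s m≤) = cong (x ∷_) (take-++ˡ xs ys m≤)

take-take-suc : ∀ {A : Set} m (w : List A) → take m (take (suc m) w) ≡ take m w
take-take-suc m w = ≡-trans (take-take m (suc m) w) (cong (λ k → take k w) (m≤n⇒m⊓n≡m (n≤1+n m)))

take-⊆ : ∀ {A : Set} k (w : List A) → take k w ⊆ w
take-⊆ k w x∈ = subst (_ ∈_) (take++drop≡id k w) (xs⊆xs++ys _ (drop k w) x∈)

drop-⊆ : ∀ {A : Set} k (w : List A) → drop k w ⊆ w
drop-⊆ k w x∈ = subst (_ ∈_) (take++drop≡id k w) (xs⊆ys++xs _ (take k w) x∈)

InjectiveOn : {A B : Set} → List A → (A → B) → Set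
InjectiveOn w f = ∀ {x y} → x ∈ w → y ∈ w → f x ≡ f y → x ≡ y

unique-map⁺ : ∀ {A B : Set} {f : A → B} {w} → InjectiveOn w f → Unique w → Unique (map f w)
unique-map⁺ {w = []}    _   []        = []
unique-map⁺ {w = x ∷ w} inj (x∉w ∷ u) =
  All.map⁺ (All.tabulate λ y∈w fx≡fy → All.lookup x∉w y∈w (inj (here refl) (there y∈w) fx≡fy))
  ∷ unique-map⁺ (λ x∈w y∈w → inj (there x∈w) (there y∈w)) u

unique-↭ : ∀ {A : Set} {xs ys : List A} → xs ↭ ys → Unique xs → Unique ys
unique-↭ {A} p = Unique-resp-↭ (↭⇒↭ₛ p)
  where open import Data.List.Relation.Binary.Permutation.Setoid.Properties (setoid A) using (Unique-resp-↭)

unique-snoc : ∀ {A : Set} {xs : List A} {x} → Unique xs → x ∉ xs → Unique (xs ++ [ x ])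
unique-snoc u x∉xs = ++⁺ u ([] ∷ []) λ { (x∈xs , here refl) → x∉xs x∈xs }

unique-++⁻ˡ : ∀ {A : Set} (xs : List A) {ys} → Unique (xs ++ ys) → Unique xs
unique-++⁻ˡ []       _        = []
unique-++⁻ˡ (x ∷ xs) (x∉ ∷ u) = All.++⁻ˡ xs x∉ ∷ unique-++⁻ˡ xs u

unique-++⁻ʳ : ∀ {A : Set} (xs : List A) {ys} → Unique (xs ++ ys) → Unique ys
unique-++⁻ʳ []       u       = u
unique-++⁻ʳ (x ∷ xs) (_ ∷ u) = unique-++⁻ʳ xs u

∈-remove : ∀ {A : Set} {x y : A} us {vs} → y ∈ us ++ x ∷ vs → y ≢ x → y ∈ us ++ vs
∈-remove us y∈ y≢x with ∈-++⁻ us y∈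
... | inj₁ y∈us         = ∈-++⁺ˡ y∈us
... | inj₂ (here y≡x)   = contradiction y≡x y≢x
... | inj₂ (there y∈vs) = ∈-++⁺ʳ us y∈vs

pigeonhole : ∀ {A : Set} {xs ys : List A} → Unique xs → xs ⊆ ys → length xs ≤ length ys
pigeonhole {xs = []}     _          _       = z≤n
pigeonhole {xs = x ∷ xs} (x∉xs ∷ u) x∷xs⊆ys with ∈-∃++ (x∷xs⊆ys (here refl))
... | us , vs , refl = subst (suc (length xs) ≤_) (sym (length-++-sucʳ us x vs))
  (s≤s (pigeonhole u λ y∈xs → ∈-remove us (x∷xs⊆ys (there y∈xs)) λ y≡x → All.lookup x∉xs y∈xs (sym y≡x)))

-- Counting smaller entries

countLess-++ : ∀ x u v → countLess x (u ++ v) ≡ countLess x u + countLess x v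
countLess-++ x []      v = refl
countLess-++ x (y ∷ u) v with y <ᵇ x
... | true  = cong suc (countLess-++ x u v)
... | false = countLess-++ x u v

countLess-≤-length : ∀ x w → countLess x w ≤ length w
countLess-≤-length x []      = z≤n
countLess-≤-length x (y ∷ w) with y <ᵇ x
... | true  = s≤s (countLess-≤-length x w)
... | false = m≤n⇒m≤1+n (countLess-≤-length x w)

countLess-mono : ∀ {x y} w → x ≤ y → countLess x w ≤ countLess y w
countLess-mono         []      x≤y = z≤n
countLess-mono {x} {y} (z ∷ w) x≤y
  with z <ᵇ x | <ᵇ-reflects-< z x | z <ᵇ y | <ᵇ-reflects-< z y
... | true  | _       | true  | _       = s≤s (countLess-mono w x≤y)
... | true  | ofʸ z<x | false | ofⁿ z≮y = contradiction (<-≤-trans z<x x≤y) z≮y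
... | false | _       | true  | _       = m≤n⇒m≤1+n (countLess-mono w x≤y)
... | false | _       | false | _       = countLess-mono w x≤y

countLess-mono-< : ∀ {x y} w → x ∈ w → x < y → countLess x w < countLess y w
countLess-mono-< {x} {y} (x ∷ w) (here refl) x<y
  rewrite <ᵇ-false {x} {x} ≤-refl | <ᵇ-true x<y = s≤s (countLess-mono w (<⇒≤ x<y))
countLess-mono-< {x} {y} (z ∷ w) (there x∈w) x<y
  with z <ᵇ x | <ᵇ-reflects-< z x | z <ᵇ y | <ᵇ-reflects-< z y
... | true  | _       | true  | _       = s≤s (countLess-mono-< w x∈w x<y)
... | true  | ofʸ z<x | false | ofⁿ z≮y = contradiction (<-trans z<x x<y) z≮y
... | false | _       | true  | _       = m≤n⇒m≤1+n (countLess-mono-< w x∈w x<y)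
... | false | _       | false | _       = countLess-mono-< w x∈w x<y

countLess-<-length : ∀ {x} w → x ∈ w → countLess x w < length w
countLess-<-length {x} (x ∷ w) (here refl)
  rewrite <ᵇ-false {x} {x} ≤-refl = s≤s (countLess-≤-length x w)
countLess-<-length {x} (z ∷ w) (there x∈w) with z <ᵇ x
... | true  = s≤s (countLess-<-length w x∈w)
... | false = m≤n⇒m≤1+n (countLess-<-length w x∈w)

countLess-all : ∀ {y} w → All (_< y) w → countLess y w ≡ length w
countLess-all []      []           = refl
countLess-all (z ∷ w) (z<y ∷ w<y) rewrite <ᵇ-true z<y = cong suc (countLess-all w w<y)

countLess-none : ∀ {y} w → All (y <_) w → countLess y w ≡ 0
countLess-none []      []           = refl
countLess-none (z ∷ w) (y<z ∷ y<w) rewrite <ᵇ-false (<⇒≤ y<z) = countLess-none w y<w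

countLess-↭ : ∀ y {xs ys} → xs ↭ ys → countLess y xs ≡ countLess y ys
countLess-↭ y refl        = refl
countLess-↭ y (prep x p) with x <ᵇ y
... | true  = cong suc (countLess-↭ y p)
... | false = countLess-↭ y p
countLess-↭ y (swap x z p) rewrite countLess-↭ y p with x <ᵇ y | z <ᵇ y
... | true  | true  = refl
... | true  | false = refl
... | false | true  = refl
... | false | false = refl
countLess-↭ y (trans p q) = ≡-trans (countLess-↭ y p) (countLess-↭ y q)

StrictlyMonotoneOn : List ℕ → (ℕ → ℕ) → Set
StrictlyMonotoneOn w f = ∀ {x y} → x ∈ w → y ∈ w → x < y → f x < f y

module _ {w : List ℕ} {f : ℕ → ℕ} (mono : StrictlyMonotoneOn w f) where

  <ᵇ-preserved : ∀ {x y} → x ∈ w → y ∈ w → (f x <ᵇ f y) ≡ (x <ᵇ y)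
  <ᵇ-preserved {x} {y} x∈w y∈w with <-cmp x y
  ... | tri< x<y _ _  = ≡-trans (<ᵇ-true (mono x∈w y∈w x<y)) (sym (<ᵇ-true x<y))
  ... | tri≈ _ refl _ = ≡-trans (<ᵇ-false {f x} ≤-refl) (sym (<ᵇ-false {x} ≤-refl))
  ... | tri> _ _ y<x  = ≡-trans (<ᵇ-false (<⇒≤ (mono y∈w x∈w y<x))) (sym (<ᵇ-false (<⇒≤ y<x)))

  countLess-map : ∀ {x} k → k ⊆ w → x ∈ w → countLess (f x) (map f k) ≡ countLess x k
  countLess-map     []      _   _   = refl
  countLess-map {x} (y ∷ k) k⊆w x∈w rewrite <ᵇ-preserved (k⊆w (here refl)) x∈w with y <ᵇ x
  ... | true  = cong suc (countLess-map k (λ z∈k → k⊆w (there z∈k)) x∈w)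
  ... | false = countLess-map k (λ z∈k → k⊆w (there z∈k)) x∈w

  red-map : red (map f w) ≡ red w
  red-map = ≡-trans (sym (map-∘ w))
    (map-cong-local (All.tabulate λ x∈w → cong suc (countLess-map w ⊆-refl x∈w)))

  monotone⇒injective : InjectiveOn w f
  monotone⇒injective {x} {y} x∈w y∈w fx≡fy with <-cmp x y
  ... | tri< x<y _ _ = contradiction fx≡fy (<⇒≢ (mono x∈w y∈w x<y))
  ... | tri≈ _ x≡y _ = x≡y
  ... | tri> _ _ y<x = contradiction (sym fx≡fy) (<⇒≢ (mono y∈w x∈w y<x))

rank : List ℕ → ℕ → ℕ
rank w x = suc (countLess x w)

rank-monotone : ∀ w → StrictlyMonotoneOn w (rank w)
rank-monotone w x∈w _ x<y = s≤s (countLess-mono-< w x∈w x<y)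

red-sublist : ∀ {k w} → k ⊆ w → red (map (rank w) k) ≡ red k
red-sublist {w = w} k⊆w = red-map (λ x∈k y∈k → rank-monotone w (k⊆w x∈k) (k⊆w y∈k))

red-idem : ∀ w → red (red w) ≡ red w
red-idem w = red-sublist ⊆-refl

red-take-red : ∀ k w → red (take k (red w)) ≡ red (take k w)
red-take-red k w = ≡-trans (cong red (take-map k w)) (red-sublist (take-⊆ k w))

red-drop-red : ∀ k w → red (drop k (red w)) ≡ red (drop k w)
red-drop-red k w = ≡-trans (cong red (drop-map k w)) (red-sublist (drop-⊆ k w))

red-snoc-top : ∀ {M} Y → All (_< M) Y → red (Y ++ [ M ]) ≡ red Y ++ [ suc (length Y) ]
red-snoc-top {M} Y Y<M = begin
  red (Y ++ [ M ])                                      ≡⟨ map-++ (rank (Y ++ [ M ])) Y [ M ] ⟩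
  map (rank (Y ++ [ M ])) Y ++ [ rank (Y ++ [ M ]) M ]
    ≡⟨ cong₂ (λ ys y → ys ++ [ y ]) (map-cong-local (All.map below Y<M)) top ⟩
  red Y ++ [ suc (length Y) ] ∎
  where
  below : ∀ {y} → y < M → rank (Y ++ [ M ]) y ≡ rank Y y
  below {y} y<M = cong suc (begin
    countLess y (Y ++ [ M ])           ≡⟨ countLess-++ y Y [ M ] ⟩
    countLess y Y + countLess y [ M ] ≡⟨ cong (countLess y Y +_) (countLess-none [ M ] (y<M ∷ [])) ⟩
    countLess y Y + 0                  ≡⟨ +-identityʳ _ ⟩
    countLess y Y                      ∎)
  top : rank (Y ++ [ M ]) M ≡ suc (length Y)
  top rewrite countLess-++ M Y [ M ] | <ᵇ-false {M} {M} ≤-refl = cong suc (≡-trans (+-identityʳ _) (countLess-all Y Y<M))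

-- Reduced words

oneTo : ℕ → List ℕ
oneTo n = map suc (upTo n)

∈-oneTo⁺ : ∀ {k n} → k < n → suc k ∈ oneTo n
∈-oneTo⁺ k<n = ∈-map⁺ suc (∈-upTo⁺ k<n)

∈-oneTo⁻ : ∀ {y n} → y ∈ oneTo n → 1 ≤ y × y ≤ n
∈-oneTo⁻ y∈ with ∈-map⁻ suc y∈
... | _ , k∈ , refl = s≤s z≤n , ∈-upTo⁻ k∈

length-oneTo : ∀ n → length (oneTo n) ≡ n
length-oneTo n = ≡-trans (length-map suc (upTo n)) (length-upTo n)

unique-oneTo : ∀ n → Unique (oneTo n)
unique-oneTo n = unique-map⁺ (λ _ _ → suc-injective) (upTo⁺ n)

oneTo-suc : ∀ n → oneTo (suc n) ≡ oneTo n ++ [ suc n ]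
oneTo-suc n = ≡-trans (cong (map suc) (sym (upTo-∷ʳ n))) (map-++ suc (upTo n) [ n ])

oneTo-< : ∀ {n} → All (_< suc n) (oneTo n)
oneTo-< = All.tabulate λ y∈ → s≤s (Product.proj₂ (∈-oneTo⁻ y∈))

record IsReduced (p : List ℕ) : Set where
  field
    unique    : Unique p
    red-fixed : red p ≡ p

red-isReduced : ∀ {w} → Unique w → IsReduced (red w)
red-isReduced {w} u = record
  { unique    = unique-map⁺ (monotone⇒injective (rank-monotone w)) u
  ; red-fixed = red-idem w
  }

map-id-local⁻ : ∀ {f : ℕ → ℕ} xs → map f xs ≡ xs → All (λ x → f x ≡ x) xs
map-id-local⁻ []       _  = []
map-id-local⁻ (x ∷ xs) eq = ∷-injectiveˡ eq ∷ map-id-local⁻ xs (∷-injectiveʳ eq)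

rank-fixed : ∀ {p y} → IsReduced p → y ∈ p → rank p y ≡ y
rank-fixed {p} R = All.lookup (map-id-local⁻ p (IsReduced.red-fixed R))

reduced-⊆-oneTo : ∀ {p} → IsReduced p → p ⊆ oneTo (length p)
reduced-⊆-oneTo {p} R y∈p = subst (_∈ oneTo (length p)) (rank-fixed R y∈p) (∈-oneTo⁺ (countLess-<-length p y∈p))

red-oneTo : ∀ n → red (oneTo n) ≡ oneTo n
red-oneTo zero    = refl
red-oneTo (suc n) = begin
  red (oneTo (suc n))                ≡⟨ cong red (oneTo-suc n) ⟩
  red (oneTo n ++ [ suc n ])         ≡⟨ red-snoc-top (oneTo n) oneTo-< ⟩
  red (oneTo n) ++ [ suc (length (oneTo n)) ] ≡⟨ cong₂ (λ ys k → ys ++ [ suc k ]) (red-oneTo n) (length-oneTo n) ⟩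
  oneTo n ++ [ suc n ]               ≡⟨ oneTo-suc n ⟨
  oneTo (suc n)                      ∎

oneTo-reduced : ∀ n → IsReduced (oneTo n)
oneTo-reduced n = record { unique = unique-oneTo n ; red-fixed = red-oneTo n }

permutation-reduced : ∀ {n p} → IsPerm n p → IsReduced p × length p ≡ n
permutation-reduced {n} {p} p↭ =
  record { unique = unique-↭ (↭-sym p↭) (unique-oneTo n) ; red-fixed = map-id-local (All.tabulate fixed) } ,
  ≡-trans (↭-length p↭) (length-oneTo n)
  where
  fixed : ∀ {y} → y ∈ p → rank p y ≡ y
  fixed {y} y∈p = ≡-trans (cong suc (countLess-↭ y p↭)) (rank-fixed (oneTo-reduced n) (∈-resp-↭ p↭ y∈p))

-- Extensions

c-below : ∀ {b x} → x < b → c b x ≡ x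
c-below x<b rewrite <ᵇ-true x<b = refl

c-above : ∀ {b x} → b ≤ x → c b x ≡ suc x
c-above b≤x rewrite <ᵇ-false b≤x = refl

c-monotone : ∀ b {x y} → x < y → c b x < c b y
c-monotone b {x} {y} x<y with x <ᵇ b | <ᵇ-reflects-< x b | y <ᵇ b | <ᵇ-reflects-< y b
... | true  | _        | true  | _        = x<y
... | true  | _        | false | _        = m≤n⇒m≤1+n x<y
... | false | ofⁿ x≮b | true  | ofʸ y<b = contradiction (<-trans x<y y<b) x≮b
... | false | _        | false | _        = s≤s x<y

c-injective : ∀ b {x y} → c b x ≡ c b y → x ≡ y
c-injective b {x} {y} eq with <-cmp x y
... | tri< x<y _ _ = contradiction eq (<⇒≢ (c-monotone b x<y))
... | tri≈ _ x≡y _ = x≡y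
... | tri> _ _ y<x = contradiction (sym eq) (<⇒≢ (c-monotone b y<x))

c-≢ : ∀ b x → c b x ≢ b
c-≢ b x with x <ᵇ b | <ᵇ-reflects-< x b
... | true  | ofʸ x<b = <⇒≢ x<b
... | false | ofⁿ x≮b = λ 1+x≡b → x≮b (subst (x <_) 1+x≡b ≤-refl)

c-suc : ∀ a y → c (suc a) (suc y) ≡ suc (c a y)
c-suc a y with y <ᵇ a
... | true  = refl
... | false = refl

c-fixes-reduced : ∀ {v k} → IsReduced v → length v ≤ k → map (c (suc k)) v ≡ v
c-fixes-reduced R v≤k = map-id-local (All.tabulate λ y∈v →
  c-below (s≤s (≤-trans (Product.proj₂ (∈-oneTo⁻ (reduced-⊆-oneTo R y∈v))) v≤k)))

unique-snoc-c : ∀ b {w} → Unique w → Unique (map (c b) w ++ [ b ])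
unique-snoc-c b u = unique-snoc (unique-map⁺ (λ _ _ → c-injective b) u) λ b∈ →
  let (y , _ , b≡) = ∈-map⁻ (c b) b∈ in c-≢ b y (sym b≡)

reinsert-red : ∀ {L x r} → IsReduced L → L ↭ x ∷ r → map (c x) (red r) ≡ r
reinsert-red {x = x} {r} R L↭x∷r =
  ≡-trans (sym (map-∘ r)) (map-id-local (All.tabulate λ y∈r → inflate y∈r (rank-in-L y∈r)))
  where
  x∉r : x ∉ r
  x∉r = Unique[x∷xs]⇒x∉xs (unique-↭ L↭x∷r (IsReduced.unique R))
  rank-in-L : ∀ {y} → y ∈ r → suc (countLess y (x ∷ r)) ≡ y
  rank-in-L {y} y∈r = ≡-trans (cong suc (sym (countLess-↭ y L↭x∷r)))
    (rank-fixed R (∈-resp-↭ (↭-sym L↭x∷r) (there y∈r)))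
  inflate : ∀ {y} → y ∈ r → suc (countLess y (x ∷ r)) ≡ y → c x (rank r y) ≡ y
  inflate {y} y∈r eq with x <ᵇ y | <ᵇ-reflects-< x y | eq
  ... | true  | ofʸ x<y | eq′ = ≡-trans (c-above (≤-pred (subst (x <_) (sym eq′) x<y))) eq′
  ... | false | ofⁿ x≮y | eq′ = ≡-trans (c-below (subst (_< x) (sym eq′) y<x)) eq′
    where
    y<x : y < x
    y<x = ≤∧≢⇒< (≮⇒≥ x≮y) λ y≡x → x∉r (subst (_∈ r) y≡x y∈r)

insert-↭ : ∀ x l → insert x l ↭ x ∷ l
insert-↭ x []      = refl
insert-↭ x (y ∷ l) with x ≤ᵇ y
... | true  = refl
... | false = trans (prep y (insert-↭ x l)) (swap y x refl)

sort-↭ : ∀ l → sort l ↭ l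
sort-↭ []      = refl
sort-↭ (x ∷ l) = trans (insert-↭ x (sort l)) (prep x (sort-↭ l))

insert-sorted : ∀ {x} l → x ∉ l → AllPairs _<_ l → AllPairs _<_ (insert x l)
insert-sorted         []      _   []          = [] ∷ []
insert-sorted {x} (y ∷ l) x∉y∷l (y<l ∷ l↑) with x ≤ᵇ y | ≤ᵇ-reflects-≤ x y
... | true  | ofʸ x≤y = (x<y ∷ All.map (<-trans x<y) y<l) ∷ y<l ∷ l↑
  where
  x<y : x < y
  x<y = ≤∧≢⇒< x≤y λ x≡y → x∉y∷l (here x≡y)
... | false | ofⁿ x≰y =
  All-resp-↭ (↭-sym (insert-↭ x l)) (≰⇒> x≰y ∷ y<l) ∷ insert-sorted l (λ x∈l → x∉y∷l (there x∈l)) l↑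

sort-sorted : ∀ l → Unique l → AllPairs _<_ (sort l)
sort-sorted []      _           = []
sort-sorted (x ∷ l) (x∉l ∷ u) =
  insert-sorted (sort l) (λ x∈ → All.lookup x∉l (∈-resp-↭ (sort-↭ l) x∈) refl) (sort-sorted l u)

nth-∈ : ∀ d L k → k < length L → nth d L k ∈ L
nth-∈ d (x ∷ L) zero    _         = here refl
nth-∈ d (x ∷ L) (suc k) (s≤s k<L) = there (nth-∈ d L k k<L)

nth-++ˡ : ∀ d L ys k → k < length L → nth d (L ++ ys) k ≡ nth d L k
nth-++ˡ d (x ∷ L) ys zero    _         = refl
nth-++ˡ d (x ∷ L) ys (suc k) (s≤s k<L) = nth-++ˡ d L ys k k<L

nth-++-length : ∀ d L y ys → nth d (L ++ y ∷ ys) (length L) ≡ y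
nth-++-length d []      y ys = refl
nth-++-length d (x ∷ L) y ys = nth-++-length d L y ys

countLess-nth : ∀ d L k → AllPairs _<_ L → k < length L → countLess (nth d L k) L ≡ k
countLess-nth d (x ∷ L) zero (x<L ∷ _) _ rewrite <ᵇ-false {x} {x} ≤-refl = countLess-none L x<L
countLess-nth d (x ∷ L) (suc k) (x<L ∷ L↑) (s≤s k<L)
  rewrite <ᵇ-true (All.lookup x<L (nth-∈ d L k k<L)) = cong suc (countLess-nth d L k L↑ k<L)

maxL-≥ : ∀ w → All (_≤ maxL w) w
maxL-≥ []      = []
maxL-≥ (x ∷ w) = m≤m⊔n x (maxL w) ∷ All.map (λ y≤ → ≤-trans y≤ (m≤n⊔m x (maxL w))) (maxL-≥ w)

extB-rank : ∀ {s k} → Unique s → k ≤ length s → countLess (extB s (suc k)) s ≡ k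
extB-rank {s} {k} u k≤ with m≤n⇒m<n∨m≡n k≤
... | inj₁ k<s = begin
  countLess (nth M (sort s ++ [ M ]) k) s ≡⟨ cong (λ z → countLess z s) (nth-++ˡ M (sort s) [ M ] k k<sort) ⟩
  countLess (nth M (sort s) k) s          ≡⟨ countLess-↭ _ (sort-↭ s) ⟨
  countLess (nth M (sort s) k) (sort s)   ≡⟨ countLess-nth M (sort s) k (sort-sorted s u) k<sort ⟩
  k                                       ∎
  where
  M = suc (maxL s)
  k<sort : k < length (sort s)
  k<sort = subst (k <_) (sym (↭-length (sort-↭ s))) k<s
... | inj₂ refl = ≡-trans (cong (λ z → countLess z s) top) (countLess-all s (All.map s≤s (maxL-≥ s)))
  where
  M = suc (maxL s)
  top : nth M (sort s ++ [ M ]) (length s) ≡ M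
  top = subst (λ z → nth M (sort s ++ [ M ]) z ≡ M) (↭-length (sort-↭ s)) (nth-++-length M (sort s) M [])

extend : List ℕ → ℕ → List ℕ
extend v j = map (c j) v ++ [ j ]

length-extend : ∀ v j → length (extend v j) ≡ suc (length v)
length-extend v j = ≡-trans (length-++ (map (c j) v)) (≡-trans (+-comm _ 1) (cong suc (length-map (c j) v)))

extend-injective : ∀ {u v l j} → extend u l ≡ extend v j → u ≡ v × l ≡ j
extend-injective {u} {v} {l} eq with ∷ʳ-injective (map (c l) u) _ eq
... | maps≡ , refl = map-injective (c-injective l) maps≡ , refl

countLess-extension-pivot : ∀ b s → countLess b (map (c b) s ++ [ b ]) ≡ countLess b s
countLess-extension-pivot b [] rewrite <ᵇ-false {b} {b} ≤-refl = refl
countLess-extension-pivot b (y ∷ s) with y <? b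
... | yes y<b rewrite c-below y<b | <ᵇ-true y<b = cong suc (countLess-extension-pivot b s)
... | no y≮b  rewrite c-above (≮⇒≥ y≮b) | <ᵇ-false {suc y} {b} (m≤n⇒m≤1+n (≮⇒≥ y≮b))
                    | <ᵇ-false {y} {b} (≮⇒≥ y≮b) = countLess-extension-pivot b s

countLess-extension : ∀ b {x} s → x ∈ s →
  countLess (c b x) (map (c b) s ++ [ b ]) ≡ c (countLess b s) (countLess x s)
countLess-extension b {x} s x∈s = begin
  countLess (c b x) (map (c b) s ++ [ b ])
    ≡⟨ countLess-++ (c b x) (map (c b) s) [ b ] ⟩
  countLess (c b x) (map (c b) s) + countLess (c b x) [ b ]
    ≡⟨ cong (_+ _) (countLess-map (λ _ _ → c-monotone b) s ⊆-refl x∈s) ⟩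
  countLess x s + countLess (c b x) [ b ]
    ≡⟨ compare-with-b ⟩
  c (countLess b s) (countLess x s) ∎
  where
  compare-with-b : countLess x s + countLess (c b x) [ b ] ≡ c (countLess b s) (countLess x s)
  compare-with-b with x <? b
  ... | yes x<b rewrite c-below x<b | <ᵇ-false {b} {x} (<⇒≤ x<b)
                      | c-below (countLess-mono-< s x∈s x<b) = +-identityʳ _
  ... | no x≮b  rewrite c-above (≮⇒≥ x≮b) | <ᵇ-true {b} {suc x} (s≤s (≮⇒≥ x≮b))
                      | c-above (countLess-mono s (≮⇒≥ x≮b)) = +-comm _ 1

red-extension : ∀ {s k} → Unique s → k ≤ length s → red (extension s (suc k)) ≡ extend (red s) (suc k)
red-extension {s} {k} u k≤s = begin
  red X                                       ≡⟨ map-++ (rank X) (map (c b) s) [ b ] ⟩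
  map (rank X) (map (c b) s) ++ [ rank X b ] ≡⟨ cong₂ (λ xs y → xs ++ [ y ]) shifted pivot ⟩
  extend (red s) (suc k)                      ∎
  where
  b = extB s (suc k)
  X = map (c b) s ++ [ b ]
  b-rank : countLess b s ≡ k
  b-rank = extB-rank u k≤s
  pivot : rank X b ≡ suc k
  pivot = cong suc (≡-trans (countLess-extension-pivot b s) b-rank)
  shifted-at : ∀ {x} → x ∈ s → rank X (c b x) ≡ c (suc k) (rank s x)
  shifted-at {x} x∈s = begin
    rank X (c b x)                          ≡⟨ cong suc (countLess-extension b s x∈s) ⟩
    suc (c (countLess b s) (countLess x s)) ≡⟨ cong (λ r → suc (c r (countLess x s))) b-rank ⟩
    suc (c k (countLess x s))               ≡⟨ c-suc k _ ⟨
    c (suc k) (rank s x)                    ∎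
  shifted : map (rank X) (map (c b) s) ≡ map (c (suc k)) (red s)
  shifted = ≡-trans (sym (map-∘ s)) (≡-trans (map-cong-local (All.tabulate shifted-at)) (map-∘ s))

extend-reduced : ∀ {v k} → IsReduced v → k ≤ length v → IsReduced (extend v (suc k))
extend-reduced {v} {k} R k≤v = subst IsReduced
  (≡-trans (red-extension (IsReduced.unique R) k≤v) (cong (λ z → extend z (suc k)) (IsReduced.red-fixed R)))
  (red-isReduced (unique-snoc-c _ (IsReduced.unique R)))

extend-red-init : ∀ {r x} → IsReduced (r ++ [ x ]) → extend (red r) x ≡ r ++ [ x ]
extend-red-init {r} {x} R = cong (_++ [ x ]) (reinsert-red R (↭-sym (∷↭∷ʳ x r)))

red-take-extend : ∀ {v} j → IsReduced v → red (take (length v) (extend v j)) ≡ v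
red-take-extend {v} j R = begin
  red (take (length v) (map (c j) v ++ [ j ])) ≡⟨ cong red (take-++ˡ (map (c j) v) [ j ] (≤-reflexive (sym map-length))) ⟩
  red (take (length v) (map (c j) v))          ≡⟨ cong red (take-all (length v) (map (c j) v) (≤-reflexive map-length)) ⟩
  red (map (c j) v)                            ≡⟨ red-map (λ _ _ → c-monotone j) ⟩
  red v                                        ≡⟨ IsReduced.red-fixed R ⟩
  v                                            ∎
  where
  map-length : length (map (c j) v) ≡ length v
  map-length = length-map (c j) v

red-drop-extend-top : ∀ {M} Y → Unique Y → All (_< M) Y →
  red (drop 1 (extend (red Y) (suc (length Y)))) ≡ red (drop 1 (Y ++ [ M ]))
red-drop-extend-top {M} Y unique-Y Y<M = begin
  red (drop 1 (map (c (suc (length Y))) (red Y) ++ [ suc (length Y) ]))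
    ≡⟨ cong (λ v → red (drop 1 (v ++ [ suc (length Y) ])))
            (c-fixes-reduced (red-isReduced unique-Y) (≤-reflexive (length-map _ Y))) ⟩
  red (drop 1 (red Y ++ [ suc (length Y) ])) ≡⟨ cong (λ v → red (drop 1 v)) (red-snoc-top Y Y<M) ⟨
  red (drop 1 (red (Y ++ [ M ])))            ≡⟨ red-drop-red 1 (Y ++ [ M ]) ⟩
  red (drop 1 (Y ++ [ M ]))                  ∎

determined-by-first : ∀ {x r y r′} → IsReduced (x ∷ r) → IsReduced (y ∷ r′) →
  red r ≡ red r′ → x ≡ y → x ∷ r ≡ y ∷ r′
determined-by-first {x} {r} {_} {r′} R R′ red≡ refl = cong (x ∷_) (begin
  r                  ≡⟨ reinsert-red R refl ⟨
  map (c x) (red r)  ≡⟨ cong (map (c x)) red≡ ⟩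
  map (c x) (red r′) ≡⟨ reinsert-red R′ refl ⟩
  r′                 ∎)

-- Only applied to nonempty words; the value at [] is irrelevant.
first : List ℕ → ℕ
first []      = 0
first (x ∷ _) = x

common-target-bound : ∀ {n u L} → Unique L →
  (∀ {q} → q ∈ L → IsReduced q × length q ≡ suc n × red (drop 1 q) ≡ u) → length L ≤ suc n
common-target-bound {n} {L = L} unique-L props =
  subst₂ _≤_ (length-map first L) (length-oneTo (suc n)) (pigeonhole (unique-map⁺ first-injective unique-L) firsts⊆)
  where
  first-injective : InjectiveOn L first
  first-injective {[]}    q∈ _ _ with props q∈
  ... | _ , () , _
  first-injective {_ ∷ _} {[]} _ q′∈ _ with props q′∈
  ... | _ , () , _
  first-injective {_ ∷ _} {_ ∷ _} q∈ q′∈ first≡ with props q∈ | props q′∈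
  ... | R , _ , target≡ | R′ , _ , target′≡ = determined-by-first R R′ (≡-trans target≡ (sym target′≡)) first≡
  firsts⊆ : map first L ⊆ oneTo (suc n)
  firsts⊆ y∈ with ∈-map⁻ first y∈
  ... | [] , q∈ , _ with props q∈
  ...   | _ , () , _
  firsts⊆ y∈ | x ∷ r , q∈ , refl with props q∈
  ...   | R , q-length , _ = subst (λ k → x ∈ oneTo k) q-length (reduced-⊆-oneTo R (here refl))

-- Factors of length n

windows-short : ∀ n w → length w < n → windows n w ≡ []
windows-short n []      _  = refl
windows-short n (x ∷ w) w<n rewrite ≤ᵇ-false w<n = windows-short n w (<-trans (n<1+n _) w<n)

windows-∷ : ∀ {n x w} → n ≤ suc (length w) → windows n (x ∷ w) ≡ take n (x ∷ w) ∷ windows n w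
windows-∷ n≤ rewrite ≤ᵇ-true n≤ = refl

windows-map : ∀ n f w → windows n (map f w) ≡ map (map f) (windows n w)
windows-map n f []      = refl
windows-map n f (x ∷ w) rewrite length-map f w with n ≤ᵇ suc (length w)
... | true  = cong₂ _∷_ (take-map n (x ∷ w)) (windows-map n f w)
... | false = windows-map n f w

suffix-∷ : ∀ {m x w} → m ≤ length w → suffix (suc m) (x ∷ w) ≡ suffix (suc m) w
suffix-∷ {x = x} {w} m≤w = cong (λ k → drop k (x ∷ w)) (+-∸-assoc 1 m≤w)

suffix-all : ∀ w → suffix (suc (length w)) w ≡ w
suffix-all w = cong (λ k → drop k w) (n∸n≡0 (length w))

suffix-length : ∀ m w → m ≤ length w → length (suffix (suc m) w) ≡ m
suffix-length m w m≤w = ≡-trans (length-drop (length w ∸ m) w) (m∸[m∸n]≡n m≤w)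

unique-suffix : ∀ n {w} → Unique w → Unique (suffix n w)
unique-suffix n {w} = drop⁺ (length w ∸ (n ∸ 1))

suffix-map : ∀ n f w → suffix n (map f w) ≡ map f (suffix n w)
suffix-map n f w =
  ≡-trans (cong (λ k → drop (k ∸ (n ∸ 1)) (map f w)) (length-map f w)) (drop-map (length w ∸ (n ∸ 1)) w)

windows-snoc : ∀ m w b → m ≤ length w →
  windows (suc m) (w ++ [ b ]) ≡ windows (suc m) w ++ [ suffix (suc m) w ++ [ b ] ]
windows-snoc zero []      b _   = refl
windows-snoc m    (x ∷ w) b m≤ with m≤n⇒m<n∨m≡n m≤
... | inj₂ refl = begin
  windows _ (x ∷ w ++ [ b ])
    ≡⟨ windows-∷ (≤-reflexive (cong suc (sym (length-snoc w b)))) ⟩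
  take _ (x ∷ w ++ [ b ]) ∷ windows _ (w ++ [ b ])
    ≡⟨ cong₂ _∷_ (take-all _ (x ∷ w ++ [ b ]) w+b≤) (windows-short _ (w ++ [ b ]) w+b≤) ⟩
  [ x ∷ w ++ [ b ] ]
    ≡⟨ cong₂ (λ Ws s → Ws ++ [ s ++ [ b ] ]) (windows-short _ (x ∷ w) ≤-refl) (suffix-all (x ∷ w)) ⟨
  windows _ (x ∷ w) ++ [ suffix (suc (suc (length w))) (x ∷ w) ++ [ b ] ] ∎
  where
  w+b≤ : length (x ∷ w ++ [ b ]) ≤ suc (suc (length w))
  w+b≤ = ≤-reflexive (cong suc (length-snoc w b))
... | inj₁ (s≤s m≤w) = begin
  windows (suc m) (x ∷ w ++ [ b ])
    ≡⟨ windows-∷ (s≤s (≤-trans m≤w (≤-trans (n≤1+n _) (≤-reflexive (sym (length-snoc w b)))))) ⟩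
  take (suc m) (x ∷ w ++ [ b ]) ∷ windows (suc m) (w ++ [ b ])
    ≡⟨ cong₂ (λ W Ws → (x ∷ W) ∷ Ws) (take-++ˡ w [ b ] m≤w) (windows-snoc m w b m≤w) ⟩
  take (suc m) (x ∷ w) ∷ windows (suc m) w ++ [ suffix (suc m) w ++ [ b ] ]
    ≡⟨ cong₂ (λ Ws s → Ws ++ [ s ++ [ b ] ]) (windows-∷ (s≤s m≤w)) (suffix-∷ m≤w) ⟨
  windows (suc m) (x ∷ w) ++ [ suffix (suc m) (x ∷ w) ++ [ b ] ] ∎

windows-shift : ∀ m w → m ≤ length w →
  take m w ∷ map (drop 1) (windows (suc m) w) ≡ map (take m) (windows (suc m) w) ++ [ suffix (suc m) w ]
windows-shift zero []      _  = refl
windows-shift m    (x ∷ w) m≤ with m≤n⇒m<n∨m≡n m≤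
... | inj₂ refl = begin
  take _ (x ∷ w) ∷ map (drop 1) (windows _ (x ∷ w))
    ≡⟨ cong₂ (λ W Ws → W ∷ map (drop 1) Ws) (take-all _ (x ∷ w) ≤-refl) short ⟩
  [ x ∷ w ]
    ≡⟨ cong₂ (λ Ws s → map (take _) Ws ++ [ s ]) short (suffix-all (x ∷ w)) ⟨
  map (take _) (windows _ (x ∷ w)) ++ [ suffix (suc (suc (length w))) (x ∷ w) ] ∎
  where
  short : windows (suc (suc (length w))) (x ∷ w) ≡ []
  short = windows-short _ (x ∷ w) ≤-refl
... | inj₁ (s≤s m≤w) = begin
  take m (x ∷ w) ∷ map (drop 1) (windows (suc m) (x ∷ w))
    ≡⟨ cong (λ Ws → take m (x ∷ w) ∷ map (drop 1) Ws) (windows-∷ (s≤s m≤w)) ⟩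
  take m (x ∷ w) ∷ take m w ∷ map (drop 1) (windows (suc m) w)
    ≡⟨ cong (take m (x ∷ w) ∷_) (windows-shift m w m≤w) ⟩
  take m (x ∷ w) ∷ map (take m) (windows (suc m) w) ++ [ suffix (suc m) w ]
    ≡⟨ cong₂ (λ W s → W ∷ map (take m) (windows (suc m) w) ++ [ s ]) (take-take-suc m (x ∷ w)) (suffix-∷ m≤w) ⟨
  take m (take (suc m) (x ∷ w)) ∷ map (take m) (windows (suc m) w) ++ [ suffix (suc m) (x ∷ w) ]
    ≡⟨ cong (λ Ws → map (take m) Ws ++ [ suffix (suc m) (x ∷ w) ]) (windows-∷ (s≤s m≤w)) ⟨
  map (take m) (windows (suc m) (x ∷ w)) ++ [ suffix (suc m) (x ∷ w) ] ∎

factor-∷ : ∀ {u w} x → Factor u w → Factor u (x ∷ w)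
factor-∷ x (xs , ys , eq) = x ∷ xs , ys , cong (x ∷_) eq

windows-factor : ∀ n w {W} → W ∈ windows n w → Factor W w × length W ≡ n
windows-factor n (x ∷ w) W∈ with n ≤ᵇ suc (length w) | ≤ᵇ-reflects-≤ n (suc (length w)) | W∈
... | true  | ofʸ n≤ | here refl =
  ([] , drop n (x ∷ w) , sym (take++drop≡id n (x ∷ w))) , ≡-trans (length-take n (x ∷ w)) (m≤n⇒m⊓n≡m n≤)
... | true  | _ | there W∈w = Product.map₁ (factor-∷ x) (windows-factor n w W∈w)
... | false | _ | W∈w       = Product.map₁ (factor-∷ x) (windows-factor n w W∈w)

unique-factor : ∀ {u w} → Factor u w → Unique w → Unique u
unique-factor (xs , ys , refl) uniq = unique-++⁻ˡ _ (unique-++⁻ʳ xs uniq)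

redFactors : ℕ → List ℕ → List (List ℕ)
redFactors n w = map red (windows n w)

redFactors-reduced : ∀ n {w q} → Unique w → q ∈ redFactors n w → IsReduced q × length q ≡ n
redFactors-reduced n {w} u q∈ with ∈-map⁻ red q∈
... | W , W∈ , refl with windows-factor n w W∈
... | W-factor , W-length = red-isReduced (unique-factor W-factor u) , ≡-trans (length-map _ W) W-length

redFactors-snoc-c : ∀ m b w → m ≤ length w →
  redFactors (suc m) (map (c b) w ++ [ b ]) ≡
  redFactors (suc m) w ++ [ red (map (c b) (suffix (suc m) w) ++ [ b ]) ]
redFactors-snoc-c m b w m≤w = begin
  map red (windows (suc m) (map (c b) w ++ [ b ]))
    ≡⟨ cong (map red) (windows-snoc m (map (c b) w) b (subst (m ≤_) (sym (length-map (c b) w)) m≤w)) ⟩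
  map red (windows (suc m) (map (c b) w) ++ [ suffix (suc m) (map (c b) w) ++ [ b ] ])
    ≡⟨ cong₂ (λ Ws s → map red (Ws ++ [ s ++ [ b ] ])) (windows-map (suc m) (c b) w) (suffix-map (suc m) (c b) w) ⟩
  map red (map (map (c b)) (windows (suc m) w) ++ [ map (c b) (suffix (suc m) w) ++ [ b ] ])
    ≡⟨ map-++ red (map (map (c b)) (windows (suc m) w)) _ ⟩
  map red (map (map (c b)) (windows (suc m) w)) ++ [ red (map (c b) (suffix (suc m) w) ++ [ b ]) ]
    ≡⟨ cong (_++ [ red (map (c b) (suffix (suc m) w) ++ [ b ]) ])
            (≡-trans (sym (map-∘ (windows (suc m) w)))
                     (map-cong (λ W → red-map {W} (λ _ _ → c-monotone b)) (windows (suc m) w))) ⟩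
  redFactors (suc m) w ++ [ red (map (c b) (suffix (suc m) w) ++ [ b ]) ] ∎

-- The greedy algorithm

isNew-true : ∀ n w e → isNew n w e ≡ true → red e ∉ redFactors n w
isNew-true n w e eq with red e ∈? redFactors n w
... | no red∉ = red∉

isNew-false : ∀ n w e → isNew n w e ≡ false → red e ∈ redFactors n w
isNew-false n w e eq with red e ∈? redFactors n w
... | yes red∈ = red∈

search-just : ∀ n w a r {i} → search n w a r ≡ just i →
  a ≤ i × i < a + r × red (extension (suffix n w) i) ∉ redFactors n w ×
  (∀ {j} → a ≤ j → j < i → red (extension (suffix n w) j) ∈ redFactors n w)
search-just n w a (suc r) {i} eq with isNew n w (extension (suffix n w) a) in new
search-just n w a (suc r) {.a} refl | true =
  ≤-refl , m<m+n a z<s , isNew-true n w _ new , λ a≤j j<a → contradiction j<a (≤⇒≯ a≤j)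
... | false with search-just n w (suc a) r eq
... | a<i , i<a+r , fresh , earlier =
  <⇒≤ a<i , subst (i <_) (sym (+-suc a r)) i<a+r , fresh , earlier′
  where
  earlier′ : ∀ {j} → a ≤ j → j < i → red (extension (suffix n w) j) ∈ redFactors n w
  earlier′ a≤j j<i with m≤n⇒m<n∨m≡n a≤j
  ... | inj₁ a<j  = earlier a<j j<i
  ... | inj₂ refl = isNew-false n w _ new

search-nothing : ∀ n w a r → search n w a r ≡ nothing →
  ∀ {j} → a ≤ j → j < a + r → red (extension (suffix n w) j) ∈ redFactors n w
search-nothing n w a zero    _  a≤j j<a+0 = contradiction (subst (_ <_) (+-identityʳ a) j<a+0) (≤⇒≯ a≤j)
search-nothing n w a (suc r) eq {j} a≤j j< with isNew n w (extension (suffix n w) a) in new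
... | false with m≤n⇒m<n∨m≡n a≤j
...   | inj₁ a<j  = search-nothing n w (suc a) r eq a<j (subst (j <_) (+-suc a r) j<)
...   | inj₂ refl = isNew-false n w _ new

step-just : ∀ n w {w′} → step n w ≡ just w′ →
  Σ ℕ λ i → search n w 1 n ≡ just i × w′ ≡ map (c (extB (suffix n w) i)) w ++ [ extB (suffix n w) i ]
step-just n w eq with search n w 1 n
step-just n w refl | just i = i , refl , refl

step-nothing : ∀ n w → step n w ≡ nothing → search n w 1 n ≡ nothing
step-nothing n w eq with search n w 1 n
step-nothing n w refl | nothing = refl

-- Maintained because each step takes the smallest new extension of the current pattern.
LowerClosed : List (List ℕ) → Set
LowerClosed C = ∀ {u l j} → extend u l ∈ C → 1 ≤ j → j < l → extend u j ∈ C

record Invariant (m : ℕ) (w : List ℕ) : Set where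
  field
    long-enough      : m ≤ length w
    distinct         : Unique w
    factors-distinct : Unique (redFactors (suc m) w)
    lower-closed     : LowerClosed (redFactors (suc m) w)
    prefix           : red (take m w) ≡ red (oneTo m)

redFactors-start : ∀ m → redFactors (suc m) (start (suc m)) ≡ []
redFactors-start m = cong (map red) (windows-short (suc m) (oneTo m) (s≤s (≤-reflexive (length-oneTo m))))

invariant-start : ∀ m → Invariant m (start (suc m))
invariant-start m = record
  { long-enough      = ≤-reflexive (sym (length-oneTo m))
  ; distinct         = unique-oneTo m
  ; factors-distinct = subst Unique (sym (redFactors-start m)) []
  ; lower-closed     = λ u∈ → contradiction (subst (_ ∈_) (redFactors-start m) u∈) λ ()
  ; prefix           = cong red (take-all m (oneTo m) (≤-reflexive (length-oneTo m)))
  }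

invariant-step : ∀ {m w w′} → Invariant m w → step (suc m) w ≡ just w′ → Invariant m w′
invariant-step {m} {w} I stepped with step-just (suc m) w stepped
... | i , found , refl with search-just (suc m) w 1 (suc m) found
... | s≤s z≤n , s≤s (s≤s k≤m) , fresh , earlier = record
  { long-enough      = ≤-trans long-enough (≤-trans (n≤1+n _) (≤-reflexive (sym (length-extend w b))))
  ; distinct         = unique-snoc-c b distinct
  ; factors-distinct = subst Unique (sym grown) (unique-snoc factors-distinct fresh)
  ; lower-closed     = subst LowerClosed (sym grown) closed
  ; prefix           = prefix′
  }
  where
  open Invariant I
  s = suffix (suc m) w
  k≤s : _ ≤ length s
  k≤s = ≤-trans k≤m (≤-reflexive (sym (suffix-length m w long-enough)))
  unique-s : Unique s
  unique-s = unique-suffix (suc m) distinct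
  b = extB s i
  grown : redFactors (suc m) (map (c b) w ++ [ b ]) ≡ redFactors (suc m) w ++ [ red (extension s i) ]
  grown = redFactors-snoc-c m b w long-enough
  earlier-extend : ∀ {j} → 1 ≤ j → j < i → extend (red s) j ∈ redFactors (suc m) w
  earlier-extend {suc j} 1≤j (s≤s j<k) =
    subst (_∈ _) (red-extension unique-s (≤-trans (<⇒≤ j<k) k≤s)) (earlier 1≤j (s≤s j<k))
  closed : LowerClosed (redFactors (suc m) w ++ [ red (extension s i) ])
  closed {u} {l} {j} u∈ 1≤j j<l with ∈-++⁻ (redFactors (suc m) w) u∈
  ... | inj₁ u∈C = ∈-++⁺ˡ (lower-closed u∈C 1≤j j<l)
  ... | inj₂ (here new) with extend-injective (≡-trans new (red-extension unique-s k≤s))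
  ...   | refl , refl = ∈-++⁺ˡ (earlier-extend 1≤j j<l)
  prefix′ : red (take m (map (c b) w ++ [ b ])) ≡ red (oneTo m)
  prefix′ = begin
    red (take m (map (c b) w ++ [ b ]))
      ≡⟨ cong red (take-++ˡ (map (c b) w) [ b ] (subst (m ≤_) (sym (length-map (c b) w)) long-enough)) ⟩
    red (take m (map (c b) w))          ≡⟨ cong red (take-map m w) ⟩
    red (map (c b) (take m w))          ≡⟨ red-map (λ _ _ → c-monotone b) ⟩
    red (take m w)                      ≡⟨ prefix ⟩
    red (oneTo m)                       ∎

invariant : ∀ {m w} → Reaches (suc m) w → Invariant m w
invariant {m} init                = invariant-start m
invariant     (next reaches stepped) = invariant-step (invariant reaches) stepped

-- Termination

wordsOver : List ℕ → ℕ → List (List ℕ)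
wordsOver A zero    = [ [] ]
wordsOver A (suc k) = concatMap (λ x → map (x ∷_) (wordsOver A k)) A

∈-wordsOver : ∀ A {q} → All (_∈ A) q → q ∈ wordsOver A (length q)
∈-wordsOver A []                  = here refl
∈-wordsOver A {x ∷ q} (x∈A ∷ q⊆A) =
  ∈-concatMap⁺ (λ y → map (y ∷_) (wordsOver A (length q)))
    (Any.map (λ { refl → ∈-map⁺ (x ∷_) (∈-wordsOver A q⊆A) }) x∈A)

module Termination (m : ℕ) where

  bound : ℕ
  bound = length (wordsOver (oneTo (suc m)) (suc m))

  redFactors-bounded : ∀ {w} → Invariant m w → length (redFactors (suc m) w) ≤ bound
  redFactors-bounded I = pigeonhole factors-distinct λ {q} q∈ →
    let (reduced , q-length) = redFactors-reduced (suc m) distinct q∈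
    in subst (λ k → q ∈ wordsOver (oneTo (suc m)) k) q-length
         (∈-wordsOver _ (All.tabulate (subst (λ k → q ⊆ oneTo k) q-length (reduced-⊆-oneTo reduced))))
    where open Invariant I

  redFactors-grow : ∀ {w w′} → Invariant m w → step (suc m) w ≡ just w′ →
    length (redFactors (suc m) w′) ≡ suc (length (redFactors (suc m) w))
  redFactors-grow {w} I stepped with step-just (suc m) w stepped
  ... | _ , _ , refl = ≡-trans (cong length (redFactors-snoc-c m _ w (Invariant.long-enough I)))
                               (length-snoc (redFactors (suc m) w) _)

  run : ∀ gap {w} → Reaches (suc m) w → length (redFactors (suc m) w) + gap ≡ suc bound →
    Σ (List ℕ) (IsOutput (suc m))
  run gap {w} reaches total with step (suc m) w in stepped
  ... | nothing = w , reaches , stepped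
  run zero    reaches total | just w′ =
    contradiction (subst (_≤ bound) (≡-trans (sym (+-identityʳ _)) total) (redFactors-bounded (invariant reaches))) 1+n≰n
  run (suc gap) reaches total | just w′ = run gap (next reaches stepped)
    (≡-trans (cong (_+ gap) (redFactors-grow (invariant reaches) stepped)) (≡-trans (sym (+-suc _ gap)) total))

  halts : Σ (List ℕ) (IsOutput (suc m))
  halts = run (suc bound) init (cong (λ C → length C + suc bound) (redFactors-start m))

-- Coverage

_≟ₗ_ : DecidableEquality (List ℕ)
_≟ₗ_ = ≡-dec _≟_

count : List ℕ → List (List ℕ) → ℕ
count u xs = length (filter (_≟ₗ u) xs)

count-++ : ∀ u xs ys → count u (xs ++ ys) ≡ count u xs + count u ys
count-++ u xs ys = ≡-trans (cong length (filter-++ (_≟ₗ u) xs ys)) (length-++ (filter (_≟ₗ u) xs))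

count-self : ∀ u → count u [ u ] ≡ 1
count-self u = cong length (filter-accept (_≟ₗ u) {xs = []} refl)

count-other : ∀ {u x} → x ≢ u → count u [ x ] ≡ 0
count-other {u} x≢u = cong length (filter-reject (_≟ₗ u) {xs = []} x≢u)

count-map : ∀ {A : Set} u (f : A → List ℕ) xs → count u (map f xs) ≡ length (filter (λ x → f x ≟ₗ u) xs)
count-map u f []       = refl
count-map u f (x ∷ xs) with does (f x ≟ₗ u)
... | true  = cong suc (count-map u f xs)
... | false = count-map u f xs

above : ℕ → ℕ → List ℕ
above m k = map (m +_) (oneTo k)

above-suc : ∀ m k → above m (suc k) ≡ above m k ++ [ m + suc k ]
above-suc m k = ≡-trans (cong (map (m +_)) (oneTo-suc k)) (map-++ (m +_) (oneTo k) [ suc k ])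

length-++-above : ∀ m Z k → length (Z ++ above m k) ≡ length Z + k
length-++-above m Z k = ≡-trans (length-++ Z) (cong (length Z +_) (≡-trans (length-map _ (oneTo k)) (length-oneTo k)))

unique-++-above : ∀ {m Z} k → Unique Z → All (_≤ m) Z → Unique (Z ++ above m k)
unique-++-above {m} k unique-Z Z≤m = ++⁺ unique-Z (unique-map⁺ (λ _ _ → +-cancelˡ-≡ m _ _) (unique-oneTo k)) disjoint
  where
  disjoint : ∀ {y} → ¬ (y ∈ _ × y ∈ above m k)
  disjoint (y∈Z , y∈above) with ∈-map⁻ (m +_) y∈above
  ... | x , x∈ , refl = contradiction (All.lookup Z≤m y∈Z) (<⇒≱ (m<m+n m (Product.proj₁ (∈-oneTo⁻ x∈))))

++-above-< : ∀ {m Z} k → All (_≤ m) Z → All (_< m + suc k) (Z ++ above m k)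
++-above-< {m} k Z≤m =
  All.++⁺ (All.map (λ y≤m → ≤-trans (s≤s (≤-trans y≤m (m≤m+n m k))) (≤-reflexive (sym (+-suc m k)))) Z≤m)
  (All.map⁺ (All.tabulate λ x∈ → +-monoʳ-< m (s≤s (Product.proj₂ (∈-oneTo⁻ x∈)))))

red-above : ∀ m k → red (above m k) ≡ red (oneTo k)
red-above m k = red-map (λ _ _ → +-monoʳ-< m)

module Coverage {m w} (I : Invariant m w) (stuck : step (suc m) w ≡ nothing) where
  open Invariant I

  C : List (List ℕ)
  C = redFactors (suc m) w

  s : List ℕ
  s = red (suffix (suc m) w)

  length-suffix : length (suffix (suc m) w) ≡ m
  length-suffix = suffix-length m w long-enough

  s-reduced : IsReduced s
  s-reduced = red-isReduced (unique-suffix (suc m) distinct)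

  length-s : length s ≡ m
  length-s = ≡-trans (length-map _ (suffix (suc m) w)) length-suffix

  source target : List ℕ → List ℕ
  source q = red (take m q)
  target q = red (drop 1 q)

  walk : red (oneTo m) ∷ map target C ≡ map source C ++ [ s ]
  walk = begin
    red (oneTo m) ∷ map target C
      ≡⟨ cong₂ _∷_ (sym prefix) (factors-through (red-drop-red 1)) ⟩
    map red (take m w ∷ map (drop 1) (windows (suc m) w))
      ≡⟨ cong (map red) (windows-shift m w long-enough) ⟩
    map red (map (take m) (windows (suc m) w) ++ [ suffix (suc m) w ])
      ≡⟨ map-++ red (map (take m) (windows (suc m) w)) _ ⟩
    map red (map (take m) (windows (suc m) w)) ++ [ s ]
      ≡⟨ cong (_++ [ s ]) (factors-through (red-take-red m)) ⟨
    map source C ++ [ s ] ∎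
    where
    factors-through : ∀ {g h : List ℕ → List ℕ} → (∀ W → g (red W) ≡ red (h W)) →
      map g C ≡ map red (map h (windows (suc m) w))
    factors-through eq =
      ≡-trans (sym (map-∘ (windows (suc m) w))) (≡-trans (map-cong eq _) (map-∘ (windows (suc m) w)))

  outgoing incoming : List ℕ → List (List ℕ)
  outgoing u = filter (λ q → source q ≟ₗ u) C
  incoming u = filter (λ q → target q ≟ₗ u) C

  balance : ∀ u → count u [ red (oneTo m) ] + length (incoming u) ≡ length (outgoing u) + count u [ s ]
  balance u = begin
    count u [ red (oneTo m) ] + length (incoming u)
      ≡⟨ cong (count u [ red (oneTo m) ] +_) (count-map u target C) ⟨
    count u [ red (oneTo m) ] + count u (map target C)
      ≡⟨ count-++ u [ red (oneTo m) ] (map target C) ⟨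
    count u (red (oneTo m) ∷ map target C)
      ≡⟨ cong (count u) walk ⟩
    count u (map source C ++ [ s ])
      ≡⟨ count-++ u (map source C) [ s ] ⟩
    count u (map source C) + count u [ s ]
      ≡⟨ cong (_+ count u [ s ]) (count-map u source C) ⟩
    length (outgoing u) + count u [ s ] ∎

  all-extensions : ∀ {v} → extend v (suc m) ∈ C → ∀ {j} → 1 ≤ j → j ≤ suc m → extend v j ∈ C
  all-extensions top 1≤j j≤ with m≤n⇒m<n∨m≡n j≤
  ... | inj₁ j<  = lower-closed top 1≤j j<
  ... | inj₂ refl = top

  stuck-extensions : ∀ {j} → 1 ≤ j → j ≤ suc m → extend s j ∈ C
  stuck-extensions {suc k} 1≤j (s≤s k≤m) =
    subst (_∈ C) (red-extension (unique-suffix (suc m) distinct) (≤-trans k≤m (≤-reflexive (sym length-suffix))))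
      (search-nothing (suc m) w 1 (suc m) (step-nothing (suc m) w stuck) 1≤j (s≤s (s≤s k≤m)))

  outgoing-full : ∀ {v} → IsReduced v → length v ≡ m → extend v (suc m) ∈ C → suc m ≤ length (outgoing v)
  outgoing-full {v} R v-length top =
    subst (_≤ length (outgoing v)) (≡-trans (length-map _ (oneTo (suc m))) (length-oneTo (suc m)))
      (pigeonhole unique-extensions extensions⊆)
    where
    unique-extensions : Unique (map (extend v) (oneTo (suc m)))
    unique-extensions = unique-map⁺ (λ _ _ eq → Product.proj₂ (extend-injective eq)) (unique-oneTo (suc m))
    extensions⊆ : map (extend v) (oneTo (suc m)) ⊆ outgoing v
    extensions⊆ q∈ with ∈-map⁻ (extend v) q∈
    ... | j , j∈ , refl = ∈-filter⁺ (λ q → source q ≟ₗ v)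
      (all-extensions top (Product.proj₁ (∈-oneTo⁻ j∈)) (Product.proj₂ (∈-oneTo⁻ j∈)))
      (subst (λ k → red (take k (extend v j)) ≡ v) v-length (red-take-extend j R))

  incoming-shape : ∀ {u q} → q ∈ incoming u → IsReduced q × length q ≡ suc m × target q ≡ u
  incoming-shape {u} q∈ =
    let (q∈C , target≡) = ∈-filter⁻ (λ q → target q ≟ₗ u) q∈
    in Product.map₂ (_, target≡) (redFactors-reduced (suc m) distinct q∈C)

  unique-incoming : ∀ u → Unique (incoming u)
  unique-incoming u = filter⁺ (λ q → target q ≟ₗ u) factors-distinct

  -- s has out-degree n and in-degree at most n, so the walk cannot end away from its start.
  start≡end : red (oneTo m) ≡ s
  start≡end with red (oneTo m) ≟ₗ s
  ... | yes eq = eq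
  ... | no ne  =
    contradiction (≤-trans too-few (outgoing-full s-reduced length-s (stuck-extensions (s≤s z≤n) ≤-refl))) 1+n≰n
    where
    into-s : length (incoming s) ≡ suc (length (outgoing s))
    into-s = ≡-trans (≡-trans (cong (_+ length (incoming s)) (sym (count-other ne))) (balance s))
                     (≡-trans (cong (length (outgoing s) +_) (count-self s)) (+-comm _ 1))
    too-few : suc (length (outgoing s)) ≤ suc m
    too-few = subst (_≤ suc m) into-s (common-target-bound (unique-incoming s) incoming-shape)

  balanced : ∀ u → length (incoming u) ≡ length (outgoing u)
  balanced u = +-cancelˡ-≡ (count u [ s ]) _ _
    (≡-trans (subst (λ v → count u [ v ] + length (incoming u) ≡ length (outgoing u) + count u [ s ])
                    start≡end (balance u))
             (+-comm (length (outgoing u)) (count u [ s ])))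

  -- All extensions of u are used by lower-closedness: out-degree n, hence in-degree n.
  saturated : ∀ {u p} → IsReduced u → length u ≡ m → extend u (suc m) ∈ C →
    IsReduced p → length p ≡ suc m → target p ≡ u → p ∈ C
  saturated {u} {p} Ru u-length top Rp p-length target≡ with p ∈? C
  ... | yes p∈C = p∈C
  ... | no p∉C  = contradiction (≤-trans (outgoing-full Ru u-length top) (≤-reflexive (sym (balanced u))))
                                 (<⇒≱ (common-target-bound (p∉incoming ∷ unique-incoming u) shape))
    where
    p∉incoming : All (p ≢_) (incoming u)
    p∉incoming = All.tabulate λ q∈ p≡q → p∉C (subst (_∈ C) (sym p≡q) (Product.proj₁ (∈-filter⁻ _ q∈)))
    shape : ∀ {q} → q ∈ p ∷ incoming u → IsReduced q × length q ≡ suc m × target q ≡ u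
    shape (here refl) = Rp , p-length , target≡
    shape (there q∈)  = incoming-shape q∈

  -- The top extension of red (z ∷ Z ++ above m k) has target red (Z ++ above m (suc k));
  -- for Z = [] the pattern is 12⋯m = s.
  top-extension-covered : ∀ Z k → Unique Z → All (_≤ m) Z → length Z + k ≡ m →
    extend (red (Z ++ above m k)) (suc m) ∈ C
  top-extension-covered [] _ _ _ refl =
    subst (λ v → extend v (suc m) ∈ C) (sym (≡-trans (red-above m m) start≡end)) (stuck-extensions (s≤s z≤n) ≤-refl)
  top-extension-covered (z ∷ Z) k unique-zZ@(_ ∷ unique-Z) zZ≤m@(_ ∷ Z≤m) length≡ =
    saturated (red-isReduced (unique-++-above (suc k) unique-Z Z≤m)) length-red-Y′
      (top-extension-covered Z (suc k) unique-Z Z≤m (≡-trans (+-suc _ k) length≡))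
      (extend-reduced (red-isReduced unique-Y) (≤-reflexive (sym length-red-Y)))
      (≡-trans (length-extend (red Y) (suc m)) (cong suc length-red-Y))
      target≡
    where
    Y = z ∷ Z ++ above m k
    unique-Y : Unique Y
    unique-Y = unique-++-above k unique-zZ zZ≤m
    length-Y : length Y ≡ m
    length-Y = ≡-trans (cong suc (length-++-above m Z k)) length≡
    length-red-Y : length (red Y) ≡ m
    length-red-Y = ≡-trans (length-map _ Y) length-Y
    length-red-Y′ : length (red (Z ++ above m (suc k))) ≡ m
    length-red-Y′ = ≡-trans (length-map _ (Z ++ above m (suc k)))
                            (≡-trans (length-++-above m Z (suc k)) (≡-trans (+-suc _ k) length≡))
    target≡ : target (extend (red Y) (suc m)) ≡ red (Z ++ above m (suc k))
    target≡ = begin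
      red (drop 1 (extend (red Y) (suc m)))          ≡⟨ cong (λ j → red (drop 1 (extend (red Y) (suc j)))) length-Y ⟨
      red (drop 1 (extend (red Y) (suc (length Y)))) ≡⟨ red-drop-extend-top Y unique-Y (++-above-< k zZ≤m) ⟩
      red ((Z ++ above m k) ++ [ m + suc k ])         ≡⟨ cong red (++-assoc Z (above m k) _) ⟩
      red (Z ++ above m k ++ [ m + suc k ])           ≡⟨ cong (λ ys → red (Z ++ ys)) (above-suc m k) ⟨
      red (Z ++ above m (suc k))                      ∎

  every-pattern-occurs : ∀ {p} → IsReduced p → length p ≡ suc m → p ∈ C
  every-pattern-occurs {p} R p-length with initLast p
  ... | r ∷ʳ′ l =
    subst (_∈ C) (extend-red-init R) (all-extensions top (Product.proj₁ l-bounds) (Product.proj₂ l-bounds))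
    where
    r-length : length r ≡ m
    r-length = suc-injective (≡-trans (sym (length-snoc r l)) p-length)
    v = red r
    v-reduced : IsReduced v
    v-reduced = red-isReduced (unique-++⁻ˡ r (IsReduced.unique R))
    v-length : length v ≡ m
    v-length = ≡-trans (length-map _ r) r-length
    v≤m : All (_≤ m) v
    v≤m = All.tabulate λ y∈ → subst (_ ≤_) v-length (Product.proj₂ (∈-oneTo⁻ (reduced-⊆-oneTo v-reduced y∈)))
    top : extend v (suc m) ∈ C
    top = subst (λ u → extend u (suc m) ∈ C)
      (≡-trans (cong red (++-identityʳ v)) (IsReduced.red-fixed v-reduced))
      (top-extension-covered v 0 (IsReduced.unique v-reduced) v≤m (≡-trans (+-identityʳ _) v-length))
    l-bounds : 1 ≤ l × l ≤ suc m
    l-bounds = Product.map₂ (λ l≤ → ≤-trans l≤ (≤-reflexive p-length))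
      (∈-oneTo⁻ (reduced-⊆-oneTo R (∈-++⁺ʳ r (here refl))))

  covers : Covers (suc m) w
  covers p p↭ with permutation-reduced p↭
  ... | R , p-length with ∈-map⁻ red (every-pattern-occurs R p-length)
  ... | W , W∈ , p≡ = W , Product.map₂ (_, sym p≡) (windows-factor (suc m) w W∈)

-- The hypothesis 2 ≤ n only serves to exclude n = 0.
lemma2p2 : (n : ℕ) → 2 ≤ n →
    Σ (List ℕ) (λ w → IsOutput n w) × ((w : List ℕ) → IsOutput n w → Covers n w)
lemma2p2 (suc m) _ = Termination.halts m , λ w (reaches , stuck) → Coverage.covers (invariant reaches) stuck
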